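{- For every subpermutation $s$, the alignment graph $G^s$ contains no cycle of nonnegative length.
   Context: A sequence $s[0],\dots,s[n-1]$ is a subpermutation if each $s[i]\in\{0,\dots,n-1\}\cup\{\star\}$ (where $\star$ is a placeholder symbol) and the subsequence $s^*$ of non-placeholder elements is a permutation of $\{0,\dots,|s^*|-1\}$. The alignment graph $G^s$ is the edge-weighted directed graph with vertex set $\{0,\dots,n\}\times\{0,\dots,|s^*|\}$ and edges: $(x,y)\to(x,y+1)$ of weight $0$ for $x\in\{0,\dots,n\}$, $y\in\{0,\dots,|s^*|-1\}$; $(x,y)\to(x+1,y)$ of weight $0$ for $x\in\{0,\dots,n-1\}$, $y\in\{0,\dots,|s^*|\}$; $(i,s[i])\to(i+1,s[i]+1)$ of weight $1$ for each $i\in\{0,\dots,n-1\}$ with $s[i]\ne\star$; and $(x,y)\to(x-1,y)$ of weight $-2$ for $x\in\{1,\dots,n\}$, $y\in\{0,\dots,|s^*|\}$. -}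

module Defs where

open import Data.Nat using (ℕ; zero; suc; _<_; _≤_)
open import Data.Fin using (Fin; toℕ)
open import Data.Vec using (Vec; lookup; toList)
open import Data.Maybe using (Maybe; just; nothing)
open import Data.List using (List; []; _∷_; length; catMaybes; upTo)
open import Data.List.Relation.Binary.Permutation.Propositional using (_↭_)
open import Data.Product using (_×_; _,_)
open import Data.Integer using (ℤ; _+_; -[1+_]) renaming (+_ to ℤ+)
open import Relation.Binary.PropositionalEquality using (_≡_)

-- A sequence s[0..n-1] over {0,...,n-1} ∪ {⋆}; ⋆ is represented by 'nothing'.
Seq : ℕ → Set
Seq n = Vec (Maybe ℕ) n

star : ∀ {n} → Seq n → List ℕ
star s = catMaybes (toList s)

starLen : ∀ {n} → Seq n → ℕ
starLen s = length (star s)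

record IsSubpermutation {n : ℕ} (s : Seq n) : Set where
  field
    inRange : ∀ (i : Fin n) (j : ℕ) → lookup s i ≡ just j → j < n
    isPerm  : star s ↭ upTo (starLen s)

-- Vertices of the alignment graph are pairs (x , y); the vertex set
-- {0..n} × {0..|s*|} is enforced by the bounds in the edge constructors.
V : Set
V = ℕ × ℕ

data Edge {n : ℕ} (s : Seq n) : V → V → ℤ → Set where
  vert  : ∀ {x y} → x ≤ n → y < starLen s →
          Edge s (x , y) (x , suc y) (ℤ+ 0)
  horiz : ∀ {x y} → x < n → y ≤ starLen s →
          Edge s (x , y) (suc x , y) (ℤ+ 0)
  diag  : ∀ (i : Fin n) {j} → lookup s i ≡ just j →
          Edge s (toℕ i , j) (suc (toℕ i) , suc j) (ℤ+ 1)
  back  : ∀ {x y} → suc x ≤ n → y ≤ starLen s →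
          Edge s (suc x , y) (x , y) (-[1+ 1 ])

-- Walk s u v vs w : a directed walk in G^s from u to v of total weight w;
-- vs is the list of vertices visited, excluding the final vertex v.
data Walk {n : ℕ} (s : Seq n) : V → V → List V → ℤ → Set where
  done : ∀ {v} → Walk s v v [] (ℤ+ 0)
  step : ∀ {u v t vs w w′} → Edge s u v w → Walk s v t vs w′ →
         Walk s u t (u ∷ vs) (w + w′)

-- The potential (x , y) ↦ x + y rises by exactly w + 1 along every edge of
-- weight w, so a closed walk through L vertices has weight −L.
module Submission where

open import Defs
open import Data.Nat using (ℕ)
open import Data.Product using (_,_)
open import Data.List using (List; []; _∷_; length)
open import Data.List.Relation.Unary.Unique.Propositional using (Unique)
open import Data.Integer using (ℤ; _≤_; _<_; +_; -_; -[1+_]; _+_; 0ℤ; 1ℤ; -<+)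
open import Data.Integer.Properties using (+-identityʳ; <⇒≱; +-0-abelianGroup)
open import Data.Integer.Tactic.RingSolver using (solve-∀)
open import Algebra.Properties.AbelianGroup +-0-abelianGroup
  using (identityʳ-unique; inverseˡ-unique)
open import Relation.Binary.PropositionalEquality
  using (_≡_; _≢_; refl; cong; module ≡-Reasoning)
open import Relation.Nullary using (¬_; contradiction)

potential : V → ℤ
potential (x , y) = + x + + y

module _ {n : ℕ} {s : Seq n} where

  potential-edge : ∀ {u v w} → Edge s u v w → potential u + (w + 1ℤ) ≡ potential v
  potential-edge (vert {x} {y} _ _)   = up (+ x) (+ y)
    where
    up : ∀ x y → x + y + (0ℤ + 1ℤ) ≡ x + (1ℤ + y)
    up = solve-∀
  potential-edge (horiz {x} {y} _ _)  = right (+ x) (+ y)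
    where
    right : ∀ x y → x + y + (0ℤ + 1ℤ) ≡ 1ℤ + x + y
    right = solve-∀
  potential-edge (diag i {j} _)       = diagonal (+ _) (+ j)
    where
    diagonal : ∀ x y → x + y + (1ℤ + 1ℤ) ≡ 1ℤ + x + (1ℤ + y)
    diagonal = solve-∀
  potential-edge (back {x} {y} _ _)   = left (+ x) (+ y)
    where
    left : ∀ x y → 1ℤ + x + y + (-[1+ 1 ] + 1ℤ) ≡ x + y
    left = solve-∀

  potential-walk : ∀ {u t vs w} → Walk s u t vs w →
                   potential u + (w + + length vs) ≡ potential t
  potential-walk {u} done = +-identityʳ (potential u)
  potential-walk {u} {t} (step {v = v} {vs = vs} {w = a} {w′ = b} e walk) = begin
    potential u + (a + b + (1ℤ + + length vs))  ≡⟨ regroup (potential u) a b (+ length vs) ⟩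
    potential u + (a + 1ℤ) + (b + + length vs)  ≡⟨ cong (_+ (b + + length vs)) (potential-edge e) ⟩
    potential v + (b + + length vs)             ≡⟨ potential-walk walk ⟩
    potential t                                 ∎
    where
    open ≡-Reasoning
    regroup : ∀ p a b l → p + (a + b + (1ℤ + l)) ≡ p + (a + 1ℤ) + (b + l)
    regroup = solve-∀

  closed-walk-weight : ∀ {v vs w} → Walk s v v vs w → w ≡ - + length vs
  closed-walk-weight {v} {vs} {w} walk =
    inverseˡ-unique w (+ length vs)
      (identityʳ-unique (potential v) (w + + length vs) (potential-walk walk))

  closed-walk-weight<0 : ∀ {v vs w} → Walk s v v vs w → vs ≢ [] → w < 0ℤ
  closed-walk-weight<0 {vs = []}    _    vs≢[] = contradiction refl vs≢[]
  closed-walk-weight<0 {vs = _ ∷ _} walk _     with refl ← closed-walk-weight walk = -<+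

lemma5p5 : (n : ℕ) (s : Seq n) → IsSubpermutation s →
           (v : V) (vs : List V) (w : ℤ) → Walk s v v vs w →
           vs ≢ [] → Unique vs → ¬ (+ 0 ≤ w)
lemma5p5 n s _ v vs w walk vs≢[] _ = <⇒≱ (closed-walk-weight<0 walk vs≢[])
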